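{- Let $G=(V,E)$ be a finite connected loopless graph, $\beta\in F_\mathbb{Z}$ and $\eta\in F_\mathbb{R}$. Then $\beta+\eta$ belongs to the Voronoi cell $\mathrm{Vor}_F(\beta)$ if and only if for every subset $S\subseteq V$, $$-\tfrac12|\mathbb{E}(S,V-S)|\le\sum_{e\in\mathbb{E}(S,V-S)}\eta_e\le\tfrac12|\mathbb{E}(S,V-S)|.$$
   Context: $\mathbb{E}$ is the set of oriented edges of $G$ ($e=uv$ has tail $u$ and head $v$, $\bar e$ is its reverse). $C^0(G,A)$ = functions $V\to A$; $C^1(G,A)$ = functions $x\colon\mathbb{E}\to A$ with $x_{\bar e}=-x_e$; $d(f)(uv)=f(v)-f(u)$; $F_A=d(C^0(G,A))$ for $A=\mathbb{Z},\mathbb{R}$. The inner product on $C^1(G,\mathbb{R})$ is $\langle x,y\rangle=\sum_{e\in E}x_ey_e$, each edge counted once with an arbitrary orientation (independent of the choice), with norm $\|\cdot\|$. For $\beta\in F_\mathbb{Z}$, $\mathrm{Vor}_F(\beta)=\{x\in F_\mathbb{R}:\|x-\beta\|\le\|x-\alpha\|\ \forall\alpha\in F_\mathbb{Z}\}$. For $C_1,C_2\subseteq V$ disjoint, $\mathbb{E}(C_1,C_2)$ is the set of oriented edges with tail in $C_1$ and head in $C_2$. -}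

module Defs where

open import Data.Nat using (ℕ; zero; suc)
open import Data.Integer using (ℤ; +_; -[1+_])
open import Data.Fin using (Fin; zero; suc)
open import Data.Bool using (Bool; true; false; if_then_else_; _∧_; not)
open import Data.Product using (Σ; ∃; _×_; _,_)
open import Data.Sum using (_⊎_)
open import Relation.Binary.PropositionalEquality using (_≡_)
open import Relation.Nullary using (¬_)
open import Algebra.Structures using (IsCommutativeRing)
open import Relation.Binary.Structures using (IsTotalOrder)
open import Relation.Binary.Construct.Closure.ReflexiveTransitive using (Star)

-- Axiomatic real numbers: a Dedekind-complete ordered field.
-- (Any model is isomorphic to ℝ; the standard library has no reals.)

record RealNumbers : Set₁ where
  infixl 6 _+_
  infixl 7 _*_
  infix  4 _≤_
  field
    Carrier      : Set
    _+_ _*_      : Carrier → Carrier → Carrier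
    -_           : Carrier → Carrier
    0# 1#        : Carrier
    _≤_          : Carrier → Carrier → Set
    isCommRing   : IsCommutativeRing _≡_ _+_ _*_ -_ 0# 1#
    isTotalOrder : IsTotalOrder _≡_ _≤_
    0≢1          : ¬ (0# ≡ 1#)
    inverse      : ∀ x → ¬ (x ≡ 0#) → Σ Carrier (λ y → x * y ≡ 1#)
    +-mono-≤     : ∀ {x y} z → x ≤ y → x + z ≤ y + z
    *-nonneg     : ∀ {x y} → 0# ≤ x → 0# ≤ y → 0# ≤ x * y
    complete     : (P : Carrier → Set) → Σ Carrier P →
                   Σ Carrier (λ b → ∀ x → P x → x ≤ b) →
                   Σ Carrier (λ s → (∀ x → P x → x ≤ s) ×
                                    (∀ b → (∀ x → P x → x ≤ b) → s ≤ b))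

-- Finite loopless (multi)graphs: vertices Fin n, edges Fin m, each edge
-- with a fixed reference orientation tail → head.

record Graph (n m : ℕ) : Set where
  field
    tail head : Fin m → Fin n
    loopless  : ∀ e → ¬ (tail e ≡ head e)

module _ {n m : ℕ} (G : Graph n m) where
  open Graph G

  Adjacent : Fin n → Fin n → Set
  Adjacent u v = Σ (Fin m) (λ e → (tail e ≡ u × head e ≡ v) ⊎ (tail e ≡ v × head e ≡ u))

  Connected : Set
  Connected = ∀ u v → Star Adjacent u v

  -- oriented edges: (e , true) = e with reference orientation, (e , false) = ē
  OEdge : Set
  OEdge = Fin m × Bool

  otail ohead : OEdge → Fin n
  otail (e , true)  = tail e
  otail (e , false) = head e
  ohead (e , true)  = head e
  ohead (e , false) = tail e

  dℤ : (Fin n → ℤ) → OEdge → ℤ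
  dℤ f o = f (ohead o) Data.Integer.- f (otail o)

  InFℤ : (OEdge → ℤ) → Set
  InFℤ x = Σ (Fin n → ℤ) (λ f → ∀ o → x o ≡ dℤ f o)

  Subset : Set
  Subset = Fin n → Bool

  inCut : Subset → OEdge → Bool
  inCut S o = S (otail o) ∧ not (S (ohead o))

  module _ (R : RealNumbers) where
    open RealNumbers R

    _-ᴿ_ : Carrier → Carrier → Carrier
    x -ᴿ y = x + (- y)

    ιℕ : ℕ → Carrier
    ιℕ zero    = 0#
    ιℕ (suc k) = 1# + ιℕ k

    ι : ℤ → Carrier
    ι (+ k)    = ιℕ k
    ι -[1+ k ] = - (1# + ιℕ k)

    sumFin : ∀ {k} → (Fin k → Carrier) → Carrier
    sumFin {zero}  f = 0#
    sumFin {suc k} f = f zero + sumFin (λ i → f (suc i))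

    dℝ : (Fin n → Carrier) → OEdge → Carrier
    dℝ g o = g (ohead o) -ᴿ g (otail o)

    InFℝ : (OEdge → Carrier) → Set
    InFℝ x = Σ (Fin n → Carrier) (λ g → ∀ o → x o ≡ dℝ g o)

    -- squared norm ‖x‖² = Σ_{e ∈ E} x_e², each edge once (reference orientation)
    normSq : (OEdge → Carrier) → Carrier
    normSq x = sumFin (λ e → x (e , true) * x (e , true))

    embed : (OEdge → ℤ) → OEdge → Carrier
    embed β o = ι (β o)

    _⊖_ : (OEdge → Carrier) → (OEdge → Carrier) → OEdge → Carrier
    (x ⊖ y) o = x o -ᴿ y o

    -- Vor_F(β) = { x ∈ F_ℝ : ‖x - β‖ ≤ ‖x - α‖ for all α ∈ F_ℤ }
    -- (comparison of norms expressed by comparison of squared norms)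
    InVor : (OEdge → ℤ) → (OEdge → Carrier) → Set
    InVor β x = InFℝ x ×
      (∀ α → InFℤ α → normSq (x ⊖ embed β) ≤ normSq (x ⊖ embed α))

    cutSum : Subset → (OEdge → Carrier) → Carrier
    cutSum S x = sumFin (λ e →
      (if inCut S (e , true)  then x (e , true)  else 0#) +
      (if inCut S (e , false) then x (e , false) else 0#))

    cutSize : Subset → Carrier
    cutSize S = cutSum S (λ _ → 1#)

    _+ᶜ_ : (OEdge → Carrier) → (OEdge → Carrier) → OEdge → Carrier
    (x +ᶜ y) o = x o + y o

-- For α = β + dh with h ∈ C⁰(G,ℤ), expanding the squares gives
-- ‖β + η − α‖² + 2⟨η, dh⟩ = ‖η‖² + ‖dh‖², so β + η ∈ Vor_F(β) iff 2⟨η, dh⟩ ≤ ‖dh‖² for every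
-- integral potential h. If h is the indicator of V − S then, η being antisymmetric, ⟨η, dh⟩ is
-- the sum of η over 𝔼(S, V − S) and ‖dh‖² = |𝔼(S, V − S)|; applied to ±h this gives the two cut
-- inequalities. Conversely, after adding a constant, h is the sum of the indicators of its
-- superlevel sets {h > k}. The pairing ⟨η, d·⟩ is additive over this decomposition and the
-- energy ‖d·‖² superadditive, because the coboundaries of two nested indicators never have
-- opposite signs on an edge.

module Submission where

open import Defs hiding (ιℕ; ι; sumFin; dℤ; dℝ)
open import Data.Nat using (ℕ)
open import Data.Integer using (ℤ)
open import Data.Product using (_×_)
open import Function using (_⇔_)

import Defs as D
open import Algebra.Bundles using (CommutativeRing)
import Algebra.Properties.Ring as RingProperties
import Algebra.Solver.Ring as RingSolver
open import Algebra.Solver.Ring.AlmostCommutativeRing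
  using (fromCommutativeRing; _-Raw-AlmostCommutative⟶_)
open import Data.Bool using (Bool; true; false; if_then_else_; _∧_; not)
open import Data.Fin using (Fin; zero; suc)
open import Data.Integer as ℤ using (-[1+_]; 0ℤ; 1ℤ; ∣_∣)
import Data.Integer.Properties as ℤₚ
open import Data.List as List using (List; allFin)
open import Data.List.Extrema.Nat using (max; xs≤max)
open import Data.List.Membership.Propositional.Properties using (∈-allFin)
import Data.List.Relation.Unary.All as All
open import Data.List.Relation.Unary.All.Properties using (map⁻)
open import Data.Maybe using (Maybe; just; nothing)
open import Data.Nat as ℕ using (zero; suc; pred; _≡ᵇ_)
import Data.Nat.Properties as ℕₚ
open import Data.Product using (∃; _,_; proj₁; proj₂)
import Data.Sign as Sign
open import Data.Sum using (inj₁; inj₂)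
open import Function using (_∘_)
open import Function.Bundles using (mk⇔)
open import Relation.Binary.Bundles using (Poset)
import Relation.Binary.Reasoning.PartialOrder as PosetReasoning
open import Relation.Binary.PropositionalEquality
  using (_≡_; refl; sym; trans; cong; cong₂; subst₂; module ≡-Reasoning)
open import Relation.Binary.Structures using (IsTotalOrder)
open import Relation.Nullary using (yes; no)

module OrderedField (R : RealNumbers) where
  open RealNumbers R

  commutativeRing : CommutativeRing _ _
  commutativeRing = record { isCommutativeRing = isCommRing }

  open CommutativeRing commutativeRing public
    using (+-identityˡ; +-identityʳ; +-comm; +-assoc; -‿inverseʳ; zeroˡ; *-identityˡ; distribˡ; distribʳ)
  open RingProperties (CommutativeRing.ring commutativeRing) public
    using (-0#≈0#; -‿involutive; -‿+-comm; -1*x≈-x; -‿distribˡ-*; -‿distribʳ-*)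
  open import Algebra.Properties.CommutativeSemigroup
    (CommutativeRing.+-commutativeSemigroup commutativeRing) public using (interchange)

  open IsTotalOrder isTotalOrder public
    using (total) renaming (refl to ≤-refl; trans to ≤-trans; reflexive to ≤-reflexive)

  ≤-poset : Poset _ _ _
  ≤-poset = record { isPartialOrder = IsTotalOrder.isPartialOrder isTotalOrder }

  module ≤-Reasoning = PosetReasoning ≤-poset
  open ≤-Reasoning

  +-monoʳ-≤ : ∀ z {x y} → x ≤ y → z + x ≤ z + y
  +-monoʳ-≤ z {x} {y} x≤y = begin
    z + x ≡⟨ +-comm z x ⟩
    x + z ≤⟨ +-mono-≤ z x≤y ⟩
    y + z ≡⟨ +-comm y z ⟩
    z + y ∎

  +-mono₂-≤ : ∀ {x y u v} → x ≤ y → u ≤ v → x + u ≤ y + v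
  +-mono₂-≤ {x} {y} {u} {v} x≤y u≤v = begin
    x + u ≤⟨ +-mono-≤ u x≤y ⟩
    y + u ≤⟨ +-monoʳ-≤ y u≤v ⟩
    y + v ∎

  +-cancelʳ-≤ : ∀ z {x y} → x + z ≤ y + z → x ≤ y
  +-cancelʳ-≤ z {x} {y} x+z≤y+z = begin
    x               ≡⟨ add-sub x ⟨
    x + z + - z     ≤⟨ +-mono-≤ (- z) x+z≤y+z ⟩
    y + z + - z     ≡⟨ add-sub y ⟩
    y               ∎
    where
    add-sub : ∀ a → a + z + - z ≡ a
    add-sub a = trans (+-assoc a z (- z)) (trans (cong (a +_) (-‿inverseʳ z)) (+-identityʳ a))

  +-cancelˡ-≤ : ∀ z {x y} → z + x ≤ z + y → x ≤ y
  +-cancelˡ-≤ z {x} {y} z+x≤z+y = +-cancelʳ-≤ z (begin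
    x + z ≡⟨ +-comm x z ⟩
    z + x ≤⟨ z+x≤z+y ⟩
    z + y ≡⟨ +-comm z y ⟩
    y + z ∎)

  neg-antimono-≤ : ∀ {x y} → x ≤ y → - y ≤ - x
  neg-antimono-≤ {x} {y} x≤y = begin
    - y                ≡⟨ cancel x (- y) ⟨
    x + (- x + - y)    ≤⟨ +-mono-≤ (- x + - y) x≤y ⟩
    y + (- x + - y)    ≡⟨ trans (cong (y +_) (+-comm (- x) (- y))) (cancel y (- x)) ⟩
    - x                ∎
    where
    cancel : ∀ a b → a + (- a + b) ≡ b
    cancel a b = trans (sym (+-assoc a (- a) b)) (trans (cong (_+ b) (-‿inverseʳ a)) (+-identityˡ b))

  x≤x+y : ∀ x {y} → 0# ≤ y → x ≤ x + y
  x≤x+y x {y} 0≤y = begin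
    x      ≡⟨ +-identityʳ x ⟨
    x + 0# ≤⟨ +-monoʳ-≤ x 0≤y ⟩
    x + y  ∎

  +-nonneg : ∀ {x y} → 0# ≤ x → 0# ≤ y → 0# ≤ x + y
  +-nonneg 0≤x 0≤y = ≤-trans (≤-reflexive (sym (+-identityʳ 0#))) (+-mono₂-≤ 0≤x 0≤y)

  0≤1 : 0# ≤ 1#
  0≤1 with total 0# 1#
  ... | inj₁ 0≤1 = 0≤1
  ... | inj₂ 1≤0 = begin
    0#          ≤⟨ *-nonneg 0≤-1 0≤-1 ⟩
    - 1# * - 1# ≡⟨ -1*x≈-x (- 1#) ⟩
    - - 1#      ≡⟨ -‿involutive 1# ⟩
    1#          ∎
    where
    0≤-1 : 0# ≤ - 1#
    0≤-1 = ≤-trans (≤-reflexive (sym -0#≈0#)) (neg-antimono-≤ 1≤0)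

bounded : ∀ {k} (f : Fin k → ℕ) → ∃ λ B → ∀ i → f i ℕ.≤ B
bounded {k} f = max 0 values , λ i → All.lookup (map⁻ (xs≤max 0 values)) (∈-allFin i)
  where
  values : List ℕ
  values = List.map f (allFin k)

∣z∣≤K⇒z+K∈ℕ : ∀ z K → ∣ z ∣ ℕ.≤ K → ∃ λ k → z ℤ.+ ℤ.+ K ≡ ℤ.+ k
∣z∣≤K⇒z+K∈ℕ (ℤ.+ a)  K _      = a ℕ.+ K , refl
∣z∣≤K⇒z+K∈ℕ -[1+ a ] K 1+a≤K  = K ℕ.∸ suc a , ℤₚ.⊖-≥ 1+a≤K

module Voronoi {n m : ℕ} (G : Graph n m) (R : RealNumbers) where
  open Graph G
  open RealNumbers R
  open OrderedField R

  ιℕ : ℕ → Carrier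
  ιℕ = D.ιℕ G R

  ι : ℤ → Carrier
  ι = D.ι G R

  sumFin : ∀ {k} → (Fin k → Carrier) → Carrier
  sumFin = D.sumFin G R

  dℤ : (Fin n → ℤ) → OEdge G → ℤ
  dℤ = D.dℤ G

  dℝ : (Fin n → Carrier) → OEdge G → Carrier
  dℝ = D.dℝ G R

  ιℕ-+ : ∀ a b → ιℕ (a ℕ.+ b) ≡ ιℕ a + ιℕ b
  ιℕ-+ zero    b = sym (+-identityˡ (ιℕ b))
  ιℕ-+ (suc a) b = trans (cong (1# +_) (ιℕ-+ a b)) (sym (+-assoc 1# (ιℕ a) (ιℕ b)))

  ιℕ-* : ∀ a b → ιℕ (a ℕ.* b) ≡ ιℕ a * ιℕ b
  ιℕ-* zero    b = sym (zeroˡ (ιℕ b))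
  ιℕ-* (suc a) b = begin
    ιℕ (b ℕ.+ a ℕ.* b)          ≡⟨ ιℕ-+ b (a ℕ.* b) ⟩
    ιℕ b + ιℕ (a ℕ.* b)         ≡⟨ cong₂ _+_ (sym (*-identityˡ (ιℕ b))) (ιℕ-* a b) ⟩
    1# * ιℕ b + ιℕ a * ιℕ b     ≡⟨ distribʳ (ιℕ b) 1# (ιℕ a) ⟨
    (1# + ιℕ a) * ιℕ b          ∎
    where open ≡-Reasoning

  ι-⊖ : ∀ a b → ι (a ℤ.⊖ b) ≡ ιℕ a + - ιℕ b
  ι-⊖ a       zero    = begin
    ι (a ℤ.⊖ 0)   ≡⟨ cong ι (ℤₚ.⊖-≥ {a} {0} ℕ.z≤n) ⟩
    ιℕ a          ≡⟨ +-identityʳ (ιℕ a) ⟨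
    ιℕ a + 0#     ≡⟨ cong (ιℕ a +_) -0#≈0# ⟨
    ιℕ a + - 0#   ∎
    where open ≡-Reasoning
  ι-⊖ zero    (suc b) = trans (cong ι (ℤₚ.⊖-≤ {0} {suc b} ℕ.z≤n)) (sym (+-identityˡ _))
  ι-⊖ (suc a) (suc b) = begin
    ι (suc a ℤ.⊖ suc b)                ≡⟨ cong ι (ℤₚ.[1+m]⊖[1+n]≡m⊖n a b) ⟩
    ι (a ℤ.⊖ b)                        ≡⟨ ι-⊖ a b ⟩
    ιℕ a + - ιℕ b                      ≡⟨ +-identityˡ _ ⟨
    0# + (ιℕ a + - ιℕ b)               ≡⟨ cong (_+ (ιℕ a + - ιℕ b)) (-‿inverseʳ 1#) ⟨
    (1# + - 1#) + (ιℕ a + - ιℕ b)      ≡⟨ interchange 1# (- 1#) (ιℕ a) (- ιℕ b) ⟩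
    (1# + ιℕ a) + (- 1# + - ιℕ b)      ≡⟨ cong ((1# + ιℕ a) +_) (-‿+-comm 1# (ιℕ b)) ⟩
    (1# + ιℕ a) + - (1# + ιℕ b)        ∎
    where open ≡-Reasoning

  ι-+ : ∀ a b → ι (a ℤ.+ b) ≡ ι a + ι b
  ι-+ -[1+ a ]  -[1+ b ]  = begin
    - (1# + (1# + ιℕ (a ℕ.+ b)))     ≡⟨ cong (λ t → - (1# + (1# + t))) (ιℕ-+ a b) ⟩
    - (1# + (1# + (ιℕ a + ιℕ b)))    ≡⟨ cong -_ (+-assoc 1# 1# (ιℕ a + ιℕ b)) ⟨
    - ((1# + 1#) + (ιℕ a + ιℕ b))    ≡⟨ cong -_ (interchange 1# 1# (ιℕ a) (ιℕ b)) ⟩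
    - ((1# + ιℕ a) + (1# + ιℕ b))    ≡⟨ -‿+-comm (1# + ιℕ a) (1# + ιℕ b) ⟨
    - (1# + ιℕ a) + - (1# + ιℕ b)    ∎
    where open ≡-Reasoning
  ι-+ -[1+ a ]  (ℤ.+ b)   = trans (ι-⊖ b (suc a)) (+-comm (ιℕ b) _)
  ι-+ (ℤ.+ a)   -[1+ b ]  = ι-⊖ a (suc b)
  ι-+ (ℤ.+ a)   (ℤ.+ b)   = ιℕ-+ a b

  ι-neg : ∀ a → ι (ℤ.- a) ≡ - ι a
  ι-neg (ℤ.+ zero)  = sym -0#≈0#
  ι-neg (ℤ.+ suc a) = refl
  ι-neg -[1+ a ]    = sym (-‿involutive _)

  ι-◃-pos : ∀ a → ι (Sign.+ ℤ.◃ a) ≡ ιℕ a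
  ι-◃-pos zero    = refl
  ι-◃-pos (suc a) = refl

  ι-◃-neg : ∀ a → ι (Sign.- ℤ.◃ a) ≡ - ιℕ a
  ι-◃-neg zero    = sym -0#≈0#
  ι-◃-neg (suc a) = refl

  ι-* : ∀ a b → ι (a ℤ.* b) ≡ ι a * ι b
  ι-* (ℤ.+ a)  (ℤ.+ b)  = trans (ι-◃-pos (a ℕ.* b)) (ιℕ-* a b)
  ι-* (ℤ.+ a)  -[1+ b ] = trans (ι-◃-neg (a ℕ.* suc b))
    (trans (cong -_ (ιℕ-* a (suc b))) (-‿distribʳ-* (ιℕ a) (ιℕ (suc b))))
  ι-* -[1+ a ] (ℤ.+ b)  = trans (ι-◃-neg (suc a ℕ.* b))
    (trans (cong -_ (ιℕ-* (suc a) b)) (-‿distribˡ-* (ιℕ (suc a)) (ιℕ b)))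
  ι-* -[1+ a ] -[1+ b ] = begin
    ι (Sign.+ ℤ.◃ (suc a ℕ.* suc b))   ≡⟨ ι-◃-pos (suc a ℕ.* suc b) ⟩
    ιℕ (suc a ℕ.* suc b)               ≡⟨ ιℕ-* (suc a) (suc b) ⟩
    x * y                              ≡⟨ -‿involutive (x * y) ⟨
    - - (x * y)                        ≡⟨ cong -_ (-‿distribˡ-* x y) ⟩
    - (- x * y)                        ≡⟨ -‿distribʳ-* (- x) y ⟩
    - x * - y                          ∎
    where
    open ≡-Reasoning
    x = ιℕ (suc a)
    y = ιℕ (suc b)

  ι-homomorphism : ℤ.+-*-rawRing -Raw-AlmostCommutative⟶ fromCommutativeRing commutativeRing
  ι-homomorphism = record
    { ⟦_⟧    = ι
    ; +-homo = ι-+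
    ; *-homo = ι-*
    ; -‿homo = ι-neg
    ; 0-homo = refl
    ; 1-homo = +-identityʳ 1#
    }

  ι-≟ : ∀ a b → Maybe (ι a ≡ ι b)
  ι-≟ a b with a ℤₚ.≟ b
  ... | yes a≡b = just (cong ι a≡b)
  ... | no  _   = nothing

  -- Integer coefficients, whose equality is decidable, let the solver cancel terms.
  open RingSolver ℤ.+-*-rawRing (fromCommutativeRing commutativeRing) ι-homomorphism ι-≟
    using (solve; _:=_; _:+_; _:-_; _:*_; :-_; con)

  ι-split : ∀ a b → ι a ≡ ι b + ι (a ℤ.- b)
  ι-split a b = begin
    ι a                         ≡⟨ solve 2 (λ x y → x := y :+ (x :- y)) refl (ι a) (ι b) ⟩
    ι b + (ι a + - ι b)         ≡⟨ cong (λ t → ι b + (ι a + t)) (ι-neg b) ⟨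
    ι b + (ι a + ι (ℤ.- b))     ≡⟨ cong (ι b +_) (ι-+ a (ℤ.- b)) ⟨
    ι b + ι (a ℤ.- b)           ∎
    where open ≡-Reasoning

  0≤ιℕ : ∀ a → 0# ≤ ιℕ a
  0≤ιℕ zero    = ≤-refl
  0≤ιℕ (suc a) = +-nonneg 0≤1 (0≤ιℕ a)

  sumFin-cong : ∀ {k} {f g : Fin k → Carrier} → (∀ i → f i ≡ g i) → sumFin f ≡ sumFin g
  sumFin-cong {zero}  f≗g = refl
  sumFin-cong {suc k} f≗g = cong₂ _+_ (f≗g zero) (sumFin-cong (f≗g ∘ suc))

  sumFin-+ : ∀ {k} (f g : Fin k → Carrier) → sumFin (λ i → f i + g i) ≡ sumFin f + sumFin g
  sumFin-+ {zero}  f g = sym (+-identityʳ 0#)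
  sumFin-+ {suc k} f g = trans (cong (f zero + g zero +_) (sumFin-+ (f ∘ suc) (g ∘ suc)))
    (interchange (f zero) (g zero) (sumFin (f ∘ suc)) (sumFin (g ∘ suc)))

  sumFin-neg : ∀ {k} (f : Fin k → Carrier) → sumFin (λ i → - f i) ≡ - sumFin f
  sumFin-neg {zero}  f = sym -0#≈0#
  sumFin-neg {suc k} f =
    trans (cong (- f zero +_) (sumFin-neg (f ∘ suc))) (-‿+-comm (f zero) (sumFin (f ∘ suc)))

  sumFin-mono-≤ : ∀ {k} {f g : Fin k → Carrier} → (∀ i → f i ≤ g i) → sumFin f ≤ sumFin g
  sumFin-mono-≤ {zero}  f≤g = ≤-refl
  sumFin-mono-≤ {suc k} f≤g = +-mono₂-≤ (f≤g zero) (sumFin-mono-≤ (f≤g ∘ suc))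

  ι-dℤ : ∀ f o → ι (dℤ f o) ≡ dℝ (ι ∘ f) o
  ι-dℤ f o = trans (ι-+ (f (ohead G o)) (ℤ.- f (otail G o)))
                   (cong (ι (f (ohead G o)) +_) (ι-neg (f (otail G o))))

  dℝ-cong : ∀ {φ ψ} → (∀ v → φ v ≡ ψ v) → ∀ o → dℝ φ o ≡ dℝ ψ o
  dℝ-cong φ≗ψ o = cong₂ (λ a b → a + - b) (φ≗ψ (ohead G o)) (φ≗ψ (otail G o))

  dℝ-+ : ∀ φ ψ o → dℝ (λ v → φ v + ψ v) o ≡ dℝ φ o + dℝ ψ o
  dℝ-+ φ ψ o = solve 4 (λ a b c d → (a :+ b) :- (c :+ d) := (a :- c) :+ (b :- d)) refl
    (φ (ohead G o)) (ψ (ohead G o)) (φ (otail G o)) (ψ (otail G o))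

  dℝ-+-const : ∀ φ c o → dℝ (λ v → φ v + c) o ≡ dℝ φ o
  dℝ-+-const φ c o =
    solve 3 (λ a b c → (a :+ c) :- (b :+ c) := a :- b) refl (φ (ohead G o)) (φ (otail G o)) c

  ι-dℤ-+ : ∀ {f g} h → (∀ v → ι (f v) ≡ ι (g v) + ι (h v)) →
           ∀ o → ι (dℤ f o) ≡ ι (dℤ g o) + dℝ (ι ∘ h) o
  ι-dℤ-+ {f} {g} h f≡g+h o = begin
    ι (dℤ f o)                       ≡⟨ ι-dℤ f o ⟩
    dℝ (ι ∘ f) o                     ≡⟨ dℝ-cong f≡g+h o ⟩
    dℝ (λ v → ι (g v) + ι (h v)) o   ≡⟨ dℝ-+ (ι ∘ g) (ι ∘ h) o ⟩
    dℝ (ι ∘ g) o + dℝ (ι ∘ h) o      ≡⟨ cong (_+ dℝ (ι ∘ h) o) (ι-dℤ g o) ⟨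
    ι (dℤ g o) + dℝ (ι ∘ h) o        ∎
    where open ≡-Reasoning

  InFℝ-antisymmetric : ∀ {x} → InFℝ G R x → ∀ e → x (e , false) ≡ - x (e , true)
  InFℝ-antisymmetric {x} (φ , x≡dφ) e = begin
    x (e , false)                        ≡⟨ x≡dφ (e , false) ⟩
    φ (tail e) + - φ (head e)            ≡⟨ solve 2 (λ a b → b :- a := :- (a :- b)) refl
                                                     (φ (head e)) (φ (tail e)) ⟩
    - (φ (head e) + - φ (tail e))        ≡⟨ cong -_ (x≡dφ (e , true)) ⟨
    - x (e , true)                       ∎
    where open ≡-Reasoning

  square-+-≥ : ∀ a b → 0# ≤ a * b → a * a + b * b ≤ (a + b) * (a + b)
  square-+-≥ a b 0≤ab = begin
    a * a + b * b                     ≤⟨ x≤x+y (a * a + b * b) (+-nonneg 0≤ab 0≤ab) ⟩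
    a * a + b * b + (a * b + a * b)   ≈⟨ solve 2 (λ a b → a :* a :+ b :* b :+ (a :* b :+ a :* b)
                                                          := (a :+ b) :* (a :+ b)) refl a b ⟩
    (a + b) * (a + b)                 ∎
    where open ≤-Reasoning

  energy : (Fin n → Carrier) → Carrier
  energy φ = sumFin (λ e → dℝ φ (e , true) * dℝ φ (e , true))

  energy-superadditive : ∀ φ ψ → (∀ e → 0# ≤ dℝ φ (e , true) * dℝ ψ (e , true)) →
                         energy φ + energy ψ ≤ energy (λ v → φ v + ψ v)
  energy-superadditive φ ψ cross = begin
    energy φ + energy ψ
      ≈⟨ sumFin-+ (λ e → dφ e * dφ e) (λ e → dψ e * dψ e) ⟨
    sumFin (λ e → dφ e * dφ e + dψ e * dψ e)
      ≤⟨ sumFin-mono-≤ (λ e → square-+-≥ (dφ e) (dψ e) (cross e)) ⟩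
    sumFin (λ e → (dφ e + dψ e) * (dφ e + dψ e))
      ≈⟨ sumFin-cong (λ e → cong (λ t → t * t) (dℝ-+ φ ψ (e , true))) ⟨
    energy (λ v → φ v + ψ v)
      ∎
    where
    open ≤-Reasoning
    dφ dψ : Fin m → Carrier
    dφ e = dℝ φ (e , true)
    dψ e = dℝ ψ (e , true)

  energy-neg : ∀ φ → energy (λ v → - φ v) ≡ energy φ
  energy-neg φ = sumFin-cong (λ e →
    solve 2 (λ a b → (:- a :- :- b) :* (:- a :- :- b) := (a :- b) :* (a :- b)) refl
      (φ (head e)) (φ (tail e)))

  module _ (η : OEdge G → Carrier) where

    pairing : (Fin n → Carrier) → Carrier
    pairing φ = sumFin (λ e → η (e , true) * dℝ φ (e , true))

    -- 2⟨η, dφ⟩ ≤ ‖dφ‖²: the point β + η is no farther from β than from β + dφ.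
    Balanced : (Fin n → Carrier) → Set
    Balanced φ = pairing φ + pairing φ ≤ energy φ

    pairing-+ : ∀ φ ψ → pairing (λ v → φ v + ψ v) ≡ pairing φ + pairing ψ
    pairing-+ φ ψ = trans
      (sumFin-cong (λ e → trans (cong (η (e , true) *_) (dℝ-+ φ ψ (e , true)))
                                (distribˡ (η (e , true)) (dℝ φ (e , true)) (dℝ ψ (e , true)))))
      (sumFin-+ (λ e → η (e , true) * dℝ φ (e , true)) (λ e → η (e , true) * dℝ ψ (e , true)))

    pairing-neg : ∀ φ → pairing (λ v → - φ v) ≡ - pairing φ
    pairing-neg φ = trans
      (sumFin-cong (λ e → solve 3 (λ y a b → y :* (:- a :- :- b) := :- (y :* (a :- b))) refl
                                   (η (e , true)) (φ (head e)) (φ (tail e))))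
      (sumFin-neg (λ e → η (e , true) * dℝ φ (e , true)))

    Balanced-cong : ∀ {φ ψ} → (∀ o → dℝ φ o ≡ dℝ ψ o) → Balanced φ → Balanced ψ
    Balanced-cong {φ} {ψ} dφ≡dψ = subst₂ _≤_ (cong₂ _+_ pairing≡ pairing≡) energy≡
      where
      pairing≡ : pairing φ ≡ pairing ψ
      pairing≡ = sumFin-cong (λ e → cong (η (e , true) *_) (dφ≡dψ (e , true)))
      energy≡ : energy φ ≡ energy ψ
      energy≡ = sumFin-cong (λ e → cong₂ _*_ (dφ≡dψ (e , true)) (dφ≡dψ (e , true)))

    Balanced-+ : ∀ {φ ψ} → Balanced φ → Balanced ψ →
                 (∀ e → 0# ≤ dℝ φ (e , true) * dℝ ψ (e , true)) → Balanced (λ v → φ v + ψ v)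
    Balanced-+ {φ} {ψ} φ-bal ψ-bal cross = begin
      pairing φψ + pairing φψ                     ≈⟨ cong₂ _+_ (pairing-+ φ ψ) (pairing-+ φ ψ) ⟩
      (pairing φ + pairing ψ) + (pairing φ + pairing ψ)
                                                  ≈⟨ interchange (pairing φ) (pairing ψ) (pairing φ) (pairing ψ) ⟩
      (pairing φ + pairing φ) + (pairing ψ + pairing ψ)
                                                  ≤⟨ +-mono₂-≤ φ-bal ψ-bal ⟩
      energy φ + energy ψ                         ≤⟨ energy-superadditive φ ψ cross ⟩
      energy φψ                                   ∎
      where
      open ≤-Reasoning
      φψ : Fin n → Carrier
      φψ v = φ v + ψ v

    Balanced-neg : ∀ {φ} → Balanced (λ v → - φ v) → - energy φ ≤ pairing φ + pairing φ
    Balanced-neg {φ} -φ-bal = begin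
      - energy φ                      ≈⟨ cong -_ (energy-neg φ) ⟨
      - energy -φ                     ≤⟨ neg-antimono-≤ -φ-bal ⟩
      - (pairing -φ + pairing -φ)     ≈⟨ cong (λ t → - (t + t)) (pairing-neg φ) ⟩
      - (- pairing φ + - pairing φ)   ≈⟨ solve 1 (λ p → :- (:- p :+ :- p) := p :+ p) refl (pairing φ) ⟩
      pairing φ + pairing φ           ∎
      where
      open ≤-Reasoning
      -φ : Fin n → Carrier
      -φ v = - φ v

  _⊕_ : (OEdge G → ℤ) → (OEdge G → Carrier) → OEdge G → Carrier
  β ⊕ η = _+ᶜ_ G R (embed G R β) η

  distSq : (OEdge G → Carrier) → (OEdge G → ℤ) → Carrier
  distSq x α = normSq G R (_⊖_ G R x (embed G R α))

  InFℝ-⊕ : ∀ {β η} → InFℤ G β → InFℝ G R η → InFℝ G R (β ⊕ η)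
  InFℝ-⊕ {β} {η} (f , β≡df) (g , η≡dg) = (λ v → ι (f v) + g v) , λ o →
    trans (cong₂ _+_ (trans (cong ι (β≡df o)) (ι-dℤ f o)) (η≡dg o)) (sym (dℝ-+ (ι ∘ f) g o))

  distSq-translate : ∀ η (α β : OEdge G → ℤ) φ →
    (∀ e → ι (α (e , true)) ≡ ι (β (e , true)) + dℝ φ (e , true)) →
    distSq (β ⊕ η) α + (pairing η φ + pairing η φ) ≡ distSq (β ⊕ η) β + energy φ
  distSq-translate η α β φ α≡β+dφ = begin
    distSq (β ⊕ η) α + (pairing η φ + pairing η φ) ≡⟨ cong (distSq (β ⊕ η) α +_) (sumFin-+ P P) ⟨
    distSq (β ⊕ η) α + sumFin (λ e → P e + P e)    ≡⟨ sumFin-+ A (λ e → P e + P e) ⟨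
    sumFin (λ e → A e + (P e + P e))               ≡⟨ sumFin-cong (λ e → edge (a e) (b e) (y e) (d e)
                                                                               (α≡β+dφ e)) ⟩
    sumFin (λ e → B e + d e * d e)                 ≡⟨ sumFin-+ B (λ e → d e * d e) ⟩
    distSq (β ⊕ η) β + energy φ                    ∎
    where
    open ≡-Reasoning
    a b y d P A B : Fin m → Carrier
    a e = ι (β (e , true))
    b e = ι (α (e , true))
    y e = η (e , true)
    d e = dℝ φ (e , true)
    P e = y e * d e
    A e = (a e + y e + - b e) * (a e + y e + - b e)
    B e = (a e + y e + - a e) * (a e + y e + - a e)
    edge : ∀ a b y d → b ≡ a + d →
           (a + y + - b) * (a + y + - b) + (y * d + y * d) ≡ (a + y + - a) * (a + y + - a) + d * d
    edge a .(a + d) y d refl = solve 3 (λ a y d →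
      (a :+ y :- (a :+ d)) :* (a :+ y :- (a :+ d)) :+ (y :* d :+ y :* d)
        := (a :+ y :- a) :* (a :+ y :- a) :+ d :* d) refl a y d

  InVor⇒Balanced : ∀ η {β} → InFℤ G β → InVor G R β (β ⊕ η) → ∀ h → Balanced η (ι ∘ h)
  InVor⇒Balanced η {β} (f , β≡df) (_ , closest) h =
    +-cancelˡ-≤ (distSq (β ⊕ η) β) (begin
    distSq (β ⊕ η) β + 2⟨η,dh⟩     ≤⟨ +-mono-≤ 2⟨η,dh⟩ (closest α (f+h , λ _ → refl)) ⟩
    distSq (β ⊕ η) α + 2⟨η,dh⟩     ≈⟨ distSq-translate η α β (ι ∘ h) α≡β+dh ⟩
    distSq (β ⊕ η) β + energy (ι ∘ h) ∎)
    where
    open ≤-Reasoning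
    2⟨η,dh⟩ : Carrier
    2⟨η,dh⟩ = pairing η (ι ∘ h) + pairing η (ι ∘ h)
    f+h : Fin n → ℤ
    f+h v = f v ℤ.+ h v
    α : OEdge G → ℤ
    α = dℤ f+h
    α≡β+dh : ∀ e → ι (α (e , true)) ≡ ι (β (e , true)) + dℝ (ι ∘ h) (e , true)
    α≡β+dh e = trans (ι-dℤ-+ {f+h} {f} h (λ v → ι-+ (f v) (h v)) (e , true))
                     (cong (λ t → ι t + dℝ (ι ∘ h) (e , true)) (sym (β≡df (e , true))))

  Balanced⇒InVor : ∀ η {β} → InFℤ G β → InFℝ G R (β ⊕ η) → (∀ h → Balanced η (ι ∘ h)) →
                   InVor G R β (β ⊕ η)
  Balanced⇒InVor η {β} (fβ , β≡dfβ) β⊕η∈Fℝ balanced = β⊕η∈Fℝ , closest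
    where
    closest : ∀ α → InFℤ G α → distSq (β ⊕ η) β ≤ distSq (β ⊕ η) α
    closest α (f , α≡df) = +-cancelʳ-≤ 2⟨η,dh⟩ (begin
      distSq (β ⊕ η) β + 2⟨η,dh⟩        ≤⟨ +-monoʳ-≤ (distSq (β ⊕ η) β) (balanced h) ⟩
      distSq (β ⊕ η) β + energy (ι ∘ h) ≈⟨ distSq-translate η α β (ι ∘ h) α≡β+dh ⟨
      distSq (β ⊕ η) α + 2⟨η,dh⟩        ∎)
      where
      open ≤-Reasoning
      h : Fin n → ℤ
      h v = f v ℤ.- fβ v
      2⟨η,dh⟩ : Carrier
      2⟨η,dh⟩ = pairing η (ι ∘ h) + pairing η (ι ∘ h)
      α≡β+dh : ∀ e → ι (α (e , true)) ≡ ι (β (e , true)) + dℝ (ι ∘ h) (e , true)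
      α≡β+dh e = trans (cong ι (α≡df (e , true)))
        (trans (ι-dℤ-+ {f} {fβ} h (λ v → ι-split (f v) (fβ v)) (e , true))
               (cong (λ t → ι t + dℝ (ι ∘ h) (e , true)) (sym (β≡dfβ (e , true)))))

  [_] : Bool → ℤ
  [ true ]  = 1ℤ
  [ false ] = 0ℤ

  cutPotential : Subset G → Fin n → ℤ
  cutPotential S v = [ not (S v) ]

  cut-edge-pairing : ∀ t h y → y * (ι [ not h ] + - ι [ not t ]) ≡
                     (if t ∧ not h then y else 0#) + (if h ∧ not t then - y else 0#)
  cut-edge-pairing true  true  = solve 1 (λ y → y :* (con 0ℤ :- con 0ℤ) := con 0ℤ :+ con 0ℤ) refl
  cut-edge-pairing true  false = solve 1 (λ y → y :* (con 1ℤ :- con 0ℤ) := y :+ con 0ℤ) refl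
  cut-edge-pairing false true  = solve 1 (λ y → y :* (con 0ℤ :- con 1ℤ) := con 0ℤ :+ :- y) refl
  cut-edge-pairing false false = solve 1 (λ y → y :* (con 1ℤ :- con 1ℤ) := con 0ℤ :+ con 0ℤ) refl

  cut-edge-energy : ∀ t h → (ι [ not h ] + - ι [ not t ]) * (ι [ not h ] + - ι [ not t ]) ≡
                    (if t ∧ not h then 1# else 0#) + (if h ∧ not t then 1# else 0#)
  cut-edge-energy true  true  =
    solve 0 ((con 0ℤ :- con 0ℤ) :* (con 0ℤ :- con 0ℤ) := con 0ℤ :+ con 0ℤ) refl
  cut-edge-energy true  false =
    trans (solve 0 ((con 1ℤ :- con 0ℤ) :* (con 1ℤ :- con 0ℤ) := con 1ℤ :+ con 0ℤ) refl)
          (cong (_+ 0#) (+-identityʳ 1#))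
  cut-edge-energy false true  =
    trans (solve 0 ((con 0ℤ :- con 1ℤ) :* (con 0ℤ :- con 1ℤ) := con 0ℤ :+ con 1ℤ) refl)
          (cong (0# +_) (+-identityʳ 1#))
  cut-edge-energy false false =
    solve 0 ((con 1ℤ :- con 1ℤ) :* (con 1ℤ :- con 1ℤ) := con 0ℤ :+ con 0ℤ) refl

  module _ (η : OEdge G → Carrier) (η-antisym : ∀ e → η (e , false) ≡ - η (e , true))
           (S : Subset G) where

    cutSum≡pairing : cutSum G R S η ≡ pairing η (ι ∘ cutPotential S)
    cutSum≡pairing = sumFin-cong (λ e →
      trans (cong (λ z → (if S (tail e) ∧ not (S (head e)) then η (e , true) else 0#) +
                         (if S (head e) ∧ not (S (tail e)) then z else 0#)) (η-antisym e))
            (sym (cut-edge-pairing (S (tail e)) (S (head e)) (η (e , true)))))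

    cutSize≡energy : cutSize G R S ≡ energy (ι ∘ cutPotential S)
    cutSize≡energy = sumFin-cong (λ e → sym (cut-edge-energy (S (tail e)) (S (head e))))

    2cutSum≡2pairing : cutSum G R S η + cutSum G R S η ≡
                       pairing η (ι ∘ cutPotential S) + pairing η (ι ∘ cutPotential S)
    2cutSum≡2pairing = cong₂ _+_ cutSum≡pairing cutSum≡pairing

    Balanced⇒cut-upper : Balanced η (ι ∘ cutPotential S) →
                         cutSum G R S η + cutSum G R S η ≤ cutSize G R S
    Balanced⇒cut-upper = subst₂ _≤_ (sym 2cutSum≡2pairing) (sym cutSize≡energy)

    cut-upper⇒Balanced : cutSum G R S η + cutSum G R S η ≤ cutSize G R S →
                         Balanced η (ι ∘ cutPotential S)
    cut-upper⇒Balanced = subst₂ _≤_ 2cutSum≡2pairing cutSize≡energy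

    Balanced⇒cut-lower : Balanced η (ι ∘ (ℤ.-_ ∘ cutPotential S)) →
                         - cutSize G R S ≤ cutSum G R S η + cutSum G R S η
    Balanced⇒cut-lower balanced =
      subst₂ _≤_ (cong -_ (sym cutSize≡energy)) (sym 2cutSum≡2pairing)
        (Balanced-neg η {ι ∘ cutPotential S}
          (Balanced-cong η {ι ∘ (ℤ.-_ ∘ cutPotential S)} {λ v → - ι (cutPotential S v)}
            (dℝ-cong (ι-neg ∘ cutPotential S)) balanced))

  layer-decomposition : ∀ a → ιℕ a ≡ ιℕ (pred a) + ι [ not (a ≡ᵇ 0) ]
  layer-decomposition zero    = sym (+-identityʳ 0#)
  layer-decomposition (suc a) =
    trans (+-comm 1# (ιℕ a)) (cong (ιℕ a +_) (sym (+-identityʳ 1#)))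

  -- Along every edge, both layers increase (weakly) in the same direction.
  layers-cross-nonneg : ∀ a b →
    0# ≤ (ιℕ (pred b) + - ιℕ (pred a)) * (ι [ not (b ≡ᵇ 0) ] + - ι [ not (a ≡ᵇ 0) ])
  layers-cross-nonneg zero    zero    =
    ≤-reflexive (solve 0 (con 0ℤ := (con 0ℤ :- con 0ℤ) :* (con 0ℤ :- con 0ℤ)) refl)
  layers-cross-nonneg zero    (suc b) = ≤-trans (0≤ιℕ b)
    (≤-reflexive (solve 1 (λ x → x := (x :- con 0ℤ) :* (con 1ℤ :- con 0ℤ)) refl (ιℕ b)))
  layers-cross-nonneg (suc a) zero    = ≤-trans (0≤ιℕ a)
    (≤-reflexive (solve 1 (λ x → x := (con 0ℤ :- x) :* (con 0ℤ :- con 1ℤ)) refl (ιℕ a)))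
  layers-cross-nonneg (suc a) (suc b) =
    ≤-reflexive (solve 2 (λ x y → con 0ℤ := (y :- x) :* (con 1ℤ :- con 1ℤ)) refl (ιℕ a) (ιℕ b))

  Balanced-ℕ : ∀ η → (∀ S → Balanced η (ι ∘ cutPotential S)) → ∀ g → Balanced η (ιℕ ∘ g)
  Balanced-ℕ η cuts g = layers (proj₁ (bounded g)) g (proj₂ (bounded g))
    where
    layers : ∀ B g → (∀ v → g v ℕ.≤ B) → Balanced η (ιℕ ∘ g)
    layers zero    g g≤0   = Balanced-cong η {ι ∘ cutPotential (λ _ → true)} {ιℕ ∘ g}
      (dℝ-cong (λ v → cong ιℕ (sym (ℕₚ.n≤0⇒n≡0 (g≤0 v)))))
      (cuts (λ _ → true))
    layers (suc B) g g≤1+B = Balanced-cong η {λ v → lower v + top v} {ιℕ ∘ g}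
      (dℝ-cong (λ v → sym (layer-decomposition (g v))))
      (Balanced-+ η {lower} {top}
        (layers B (pred ∘ g) (λ v → ℕₚ.pred-mono-≤ (g≤1+B v)))
        (cuts (λ v → g v ≡ᵇ 0))
        (λ e → layers-cross-nonneg (g (tail e)) (g (head e))))
      where
      lower top : Fin n → Carrier
      lower v = ιℕ (pred (g v))
      top v = ι [ not (g v ≡ᵇ 0) ]

  Balanced-ℤ : ∀ η → (∀ g → Balanced η (ιℕ ∘ g)) → ∀ h → Balanced η (ι ∘ h)
  Balanced-ℤ η balanced h = Balanced-cong η {ιℕ ∘ g} {ι ∘ h}
    (λ o → trans (dℝ-cong {ιℕ ∘ g} {λ v → ι (h v) + ιℕ K} ιg≡ιh+K o)
                 (dℝ-+-const (ι ∘ h) (ιℕ K) o))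
    (balanced g)
    where
    K : ℕ
    K = proj₁ (bounded (∣_∣ ∘ h))
    shifted : ∀ v → ∃ λ k → h v ℤ.+ ℤ.+ K ≡ ℤ.+ k
    shifted v = ∣z∣≤K⇒z+K∈ℕ (h v) K (proj₂ (bounded (∣_∣ ∘ h)) v)
    g : Fin n → ℕ
    g v = proj₁ (shifted v)
    ιg≡ιh+K : ∀ v → ιℕ (g v) ≡ ι (h v) + ιℕ K
    ιg≡ιh+K v = trans (cong ι (sym (proj₂ (shifted v)))) (ι-+ (h v) (ℤ.+ K))

  CutBounds : (OEdge G → Carrier) → Set
  CutBounds η = ∀ S →
      - cutSize G R S ≤ cutSum G R S η + cutSum G R S η
    × cutSum G R S η + cutSum G R S η ≤ cutSize G R S

  InVor⇒CutBounds : ∀ {β η} → InFℤ G β → InFℝ G R η → InVor G R β (β ⊕ η) → CutBounds η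
  InVor⇒CutBounds {β} {η} β∈Fℤ η∈Fℝ β⊕η∈Vor S =
      Balanced⇒cut-lower η η-antisym S (balanced (ℤ.-_ ∘ cutPotential S))
    , Balanced⇒cut-upper η η-antisym S (balanced (cutPotential S))
    where
    η-antisym : ∀ e → η (e , false) ≡ - η (e , true)
    η-antisym = InFℝ-antisymmetric η∈Fℝ
    balanced : ∀ h → Balanced η (ι ∘ h)
    balanced = InVor⇒Balanced η β∈Fℤ β⊕η∈Vor

  CutBounds⇒InVor : ∀ {β η} → InFℤ G β → InFℝ G R η → CutBounds η → InVor G R β (β ⊕ η)
  CutBounds⇒InVor {β} {η} β∈Fℤ η∈Fℝ bounds =
    Balanced⇒InVor η β∈Fℤ (InFℝ-⊕ β∈Fℤ η∈Fℝ) (Balanced-ℤ η (Balanced-ℕ η cut-balanced))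
    where
    cut-balanced : ∀ S → Balanced η (ι ∘ cutPotential S)
    cut-balanced S = cut-upper⇒Balanced η (InFℝ-antisymmetric η∈Fℝ) S (proj₂ (bounds S))

proposition3p12 : (R : RealNumbers) → let open RealNumbers R in
    {n m : ℕ} (G : Graph n m) → Connected G →
    (β : OEdge G → ℤ) → InFℤ G β →
    (η : OEdge G → Carrier) → InFℝ G R η →
    InVor G R β (_+ᶜ_ G R (embed G R β) η) ⇔
    (∀ (S : Subset G) →
        (- cutSize G R S) ≤ cutSum G R S η + cutSum G R S η
      × cutSum G R S η + cutSum G R S η ≤ cutSize G R S)
proposition3p12 R G _ β β∈Fℤ η η∈Fℝ =
  mk⇔ (InVor⇒CutBounds β∈Fℤ η∈Fℝ) (CutBounds⇒InVor β∈Fℤ η∈Fℝ)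
  where open Voronoi G R
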